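{- If $G$ and $H$ are regular graphs and the strong product $G\boxtimes H$ is closed distance magic, then $-1\in Sp(G)\cup Sp(H)$.
   Context: $Sp(G)$ denotes the set of eigenvalues of the adjacency matrix of $G$. The strong product $G\boxtimes H$ has vertex set $V(G)\times V(H)$, and $(g,h)$, $(g',h')$ are adjacent iff either $g=g'$ and $hh'\in E(H)$, or $h=h'$ and $gg'\in E(G)$, or $gg'\in E(G)$ and $hh'\in E(H)$. A graph on $n$ vertices is closed distance magic if there is a bijection $\ell\colon V\to\{1,\dots,n\}$ and a positive integer $k'$ such that the sum of $\ell$ over the closed neighborhood $N[x]$ of every vertex $x$ equals $k'$. -}

module Defs where

open import Data.Bool using (Bool; true; false; _∨_; _∧_; if_then_else_)
open import Data.Nat as ℕ using (ℕ; zero; suc; _<_)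
open import Data.Fin using (Fin; zero; suc; toℕ; remQuot; _≟_)
open import Data.Product using (Σ; ∃; _×_; _,_; proj₁; proj₂)
open import Data.Rational as ℚ using (ℚ; 0ℚ; 1ℚ)
open import Relation.Binary.PropositionalEquality using (_≡_; _≢_)
open import Relation.Nullary.Decidable using (⌊_⌋)
open import Function.Definitions using (Bijective)

record Graph : Set where
  field
    n     : ℕ
    adj   : Fin n → Fin n → Bool
    sym   : ∀ x y → adj x y ≡ adj y x
    irrefl : ∀ x → adj x x ≡ false
open Graph public

Σℕ : (n : ℕ) → (Fin n → ℕ) → ℕ
Σℕ zero    f = 0
Σℕ (suc n) f = f zero ℕ.+ Σℕ n (λ i → f (suc i))

Σℚ : (n : ℕ) → (Fin n → ℚ) → ℚ
Σℚ zero    f = 0ℚ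
Σℚ (suc n) f = f zero ℚ.+ Σℚ n (λ i → f (suc i))

degree : (G : Graph) → Fin (n G) → ℕ
degree G x = Σℕ (n G) (λ y → if adj G x y then 1 else 0)

Regular : Graph → Set
Regular G = ∃ λ r → ∀ x → degree G x ≡ r

adjMatrix : (G : Graph) → Fin (n G) → Fin (n G) → ℚ
adjMatrix G x y = if adj G x y then 1ℚ else 0ℚ

_∈Sp_ : ℚ → Graph → Set
λ' ∈Sp G = Σ (Fin (n G) → ℚ) λ v →
  (∃ λ i → v i ≢ 0ℚ) ×
  (∀ x → Σℚ (n G) (λ y → adjMatrix G x y ℚ.* v y) ≡ λ' ℚ.* v x)

-- strong product, vertex set Fin (nG * nH) ≅ Fin nG × Fin nH via remQuot
strongAdj : (G H : Graph) → Fin (n G ℕ.* n H) → Fin (n G ℕ.* n H) → Bool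
strongAdj G H p q with remQuot (n H) p | remQuot (n H) q
... | (g , h) | (g' , h') =
  (⌊ g ≟ g' ⌋ ∧ adj H h h') ∨ ((⌊ h ≟ h' ⌋ ∧ adj G g g') ∨ (adj G g g' ∧ adj H h h'))

inClosedNbhd : (N : ℕ) → (Fin N → Fin N → Bool) → Fin N → Fin N → Bool
inClosedNbhd N a x y = ⌊ x ≟ y ⌋ ∨ a x y

-- closed distance magic: bijection ℓ : V → {1..N} (encoded as ℓ' : Fin N → Fin N,
-- ℓ x = 1 + toℕ (ℓ' x)) and positive k' with Σ_{y ∈ N[x]} ℓ y = k' for all x
ClosedDistanceMagic : (N : ℕ) → (Fin N → Fin N → Bool) → Set
ClosedDistanceMagic N a = Σ (Fin N → Fin N) λ ℓ' → Bijective _≡_ _≡_ ℓ' ×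
  ∃ λ k' → 0 < k' ×
    (∀ x → Σℕ N (λ y → if inClosedNbhd N a x y then suc (toℕ (ℓ' y)) else 0) ≡ k')

-- Write N_G = I + A_G for the closed-neighbourhood matrix of G. The closed
-- neighbourhood matrix of G ⊠ H is the Kronecker product N_G ⊗ N_H, so a closed
-- distance magic labelling ℓ with magic constant k satisfies (N_G ⊗ N_H) ℓ = k·𝟙.
-- If G is r-regular and H is s-regular then (N_G ⊗ N_H) 𝟙 = (r+1)(s+1)·𝟙, hence
-- w = (r+1)(s+1)·ℓ − k·𝟙 lies in the kernel of N_G ⊗ N_H, and w ≠ 0 because ℓ
-- takes the values 1 and 2. Writing w as a grid W(g,h), either some column
-- g ↦ (N_H W(g,·))(h) is nonzero, and N_G kills it, or all of them vanish and N_H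
-- kills a nonzero row of W. A nonzero kernel vector of I + A is an eigenvector of A
-- for −1.
module Submission where

open import Defs hiding (sym)
open import Data.Sum using (_⊎_)
open import Data.Rational using (-_; 1ℚ)

open import Algebra.Bundles using (Monoid; CommutativeRing)
open import Data.Bool using (Bool; true; false; _∨_; _∧_; if_then_else_)
open import Data.Bool.Solver using (module ∨-∧-Solver)
open import Data.Fin using (Fin; zero; suc; toℕ; combine; remQuot; _↑ˡ_; _↑ʳ_; _≟_)
open import Data.Fin.Properties
  using (any?; suc-injective; remQuot-combine; combine-remQuot; combine-injectiveˡ; combine-injectiveʳ)
open import Data.Nat as ℕ using (ℕ; zero; suc; s≤s)
open import Data.Product using (∃; ∃₂; _×_; _,_; proj₁; proj₂)
import Data.Rational.Properties as ℚ
open import Data.Rational.Solver using (module +-*-Solver)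
open import Data.Sum using (inj₁; inj₂)
import Data.Sum as Sum
open import Data.Vec.Functional using (Vector)
open import Function.Base using (_∘_)
open import Function.Definitions using (Surjective)
open import Relation.Binary.PropositionalEquality.Core using (_≡_)
open import Relation.Nullary using (yes; no; ¬?; contradiction)
open import Relation.Nullary.Decidable
  using (⌊_⌋; ⌊⌋-map′; isYes≗does; decidable-stable; dec-true; dec-false)

private
  variable
    k l : ℕ

module _ {a ℓ} (M : Monoid a ℓ) where
  open Monoid M
  open import Algebra.Properties.Monoid.Sum M using () renaming (sum to ∑)
  open import Relation.Binary.Reasoning.Setoid setoid

  sum-↑ : ∀ m n (f : Vector Carrier (m ℕ.+ n)) →
          ∑ f ≈ ∑ (λ i → f (i ↑ˡ n)) ∙ ∑ (λ j → f (m ↑ʳ j))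
  sum-↑ zero    n f = sym (identityˡ _)
  sum-↑ (suc m) n f = begin
    f zero ∙ ∑ (λ i → f (suc i))
      ≈⟨ ∙-congˡ (sum-↑ m n (λ i → f (suc i))) ⟩
    f zero ∙ (∑ (λ i → f (suc (i ↑ˡ n))) ∙ ∑ (λ j → f (suc (m ↑ʳ j))))
      ≈⟨ assoc _ _ _ ⟨
    (f zero ∙ ∑ (λ i → f (suc (i ↑ˡ n)))) ∙ ∑ (λ j → f (suc (m ↑ʳ j)))
      ∎

  sum-combine : ∀ m n (f : Vector Carrier (m ℕ.* n)) →
                ∑ f ≈ ∑ (λ (i : Fin m) → ∑ (λ (j : Fin n) → f (combine i j)))
  sum-combine zero    n f = refl
  sum-combine (suc m) n f =
    trans (sum-↑ n (m ℕ.* n) f) (∙-congˡ (sum-combine m n (λ k → f (n ↑ʳ k))))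

∧-∨-expand : ∀ a b c d → (a ∧ c) ∨ ((a ∧ d) ∨ ((c ∧ b) ∨ (b ∧ d))) ≡ (a ∨ b) ∧ (c ∨ d)
∧-∨-expand = solve 4 (λ a b c d → (a :* c) :+ ((a :* d) :+ ((c :* b) :+ (b :* d))) := (a :+ b) :* (c :+ d)) refl
  where
  open ∨-∧-Solver
  open import Relation.Binary.PropositionalEquality.Core using (refl)

-- Scoped so that ℚ's _*_ and _≤_ do not clash with ℕ's in the statement of mainTheorem6.
module _ where
  open import Data.Rational using (ℚ; 0ℚ; _+_; _-_; _*_; _≤_)
  open import Algebra.Properties.Semiring.Sum (CommutativeRing.semiring ℚ.+-*-commutativeRing)
    using (sum; sum-cong-≗; sum-replicate-zero; ∑-distrib-+; *-distribˡ-sum)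
  import Algebra.Properties.Semiring.Mult (CommutativeRing.semiring ℚ.+-*-commutativeRing) as Mult
  open import Relation.Binary.PropositionalEquality
  open +-*-Solver using (solve; _:+_; _:-_; :-_; _:*_; _:=_; con)
  open ≡-Reasoning

  Σℚ≡sum : ∀ n (f : Vector ℚ n) → Σℚ n f ≡ sum f
  Σℚ≡sum zero    f = refl
  Σℚ≡sum (suc n) f = cong (f zero +_) (Σℚ≡sum n (λ i → f (suc i)))

  fromℕ : ℕ → ℚ
  fromℕ k = k Mult.× 1ℚ

  fromℕ-Σℕ : ∀ n (f : Fin n → ℕ) → fromℕ (Σℕ n f) ≡ sum (λ i → fromℕ (f i))
  fromℕ-Σℕ zero    f = refl
  fromℕ-Σℕ (suc n) f =
    trans (Mult.×-homo-+ 1ℚ (f zero) _) (cong (fromℕ (f zero) +_) (fromℕ-Σℕ n (λ i → f (suc i))))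

  fromℕ-nonNeg : ∀ k → 0ℚ ≤ fromℕ k
  fromℕ-nonNeg zero    = ℚ.≤-refl
  fromℕ-nonNeg (suc k) = ℚ.+-mono-≤ (ℚ.nonNegative⁻¹ 1ℚ) (fromℕ-nonNeg k)

  fromℕ-suc≢0 : ∀ k → fromℕ (suc k) ≢ 0ℚ
  fromℕ-suc≢0 k eq = ℚ.<-irrefl (sym eq) (ℚ.+-mono-<-≤ (ℚ.positive⁻¹ 1ℚ) (fromℕ-nonNeg k))

  fromℕ-suc*fromℕ-suc≢0 : ∀ r s → fromℕ (suc r) * fromℕ (suc s) ≢ 0ℚ
  fromℕ-suc*fromℕ-suc≢0 r s eq =
    fromℕ-suc≢0 (s ℕ.+ r ℕ.* suc s) (trans (Mult.×1-homo-* (suc r) (suc s)) eq)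

  Matrix : ℕ → Set
  Matrix n = Fin n → Fin n → ℚ

  infixl 7 _·_
  _·_ : Matrix k → Vector ℚ k → Vector ℚ k
  (M · v) x = sum (λ y → M x y * v y)

  Singular : Matrix k → Set
  Singular {k} M = ∃ λ (v : Vector ℚ k) → (∃ λ i → v i ≢ 0ℚ) × (∀ x → (M · v) x ≡ 0ℚ)

  ·-cong : (M : Matrix k) {u v : Vector ℚ k} → (∀ y → u y ≡ v y) → ∀ x → (M · u) x ≡ (M · v) x
  ·-cong M u≗v x = sum-cong-≗ (λ y → cong (M x y *_) (u≗v y))

  ·-affine : (M : Matrix k) (c d : ℚ) (v : Vector ℚ k) →
             ∀ x → (M · (λ y → c * v y - d)) x ≡ c * (M · v) x - d * (M · (λ _ → 1ℚ)) x
  ·-affine M c d v x = begin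
    sum (λ y → M x y * (c * v y - d))
      ≡⟨ sum-cong-≗ (λ y → expand (M x y) (v y)) ⟩
    sum (λ y → c * (M x y * v y) + (- d) * (M x y * 1ℚ))
      ≡⟨ ∑-distrib-+ (λ y → c * (M x y * v y)) (λ y → (- d) * (M x y * 1ℚ)) ⟩
    sum (λ y → c * (M x y * v y)) + sum (λ y → (- d) * (M x y * 1ℚ))
      ≡⟨ cong₂ _+_ (*-distribˡ-sum c (λ y → M x y * v y)) (*-distribˡ-sum (- d) (λ y → M x y * 1ℚ)) ⟨
    c * (M · v) x + (- d) * (M · (λ _ → 1ℚ)) x
      ≡⟨ cong (c * (M · v) x +_) (ℚ.neg-distribˡ-* d _) ⟨
    c * (M · v) x - d * (M · (λ _ → 1ℚ)) x
      ∎
    where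
    expand : ∀ a b → a * (c * b - d) ≡ c * (a * b) + (- d) * (a * 1ℚ)
    expand = solve 4 (λ c d a b → a :* (c :* b :- d) := c :* (a :* b) :+ (:- d) :* (a :* con 1ℚ)) refl c d

  nonzero-or-zero : (W : Fin k → Fin l → ℚ) → (∃₂ λ g h → W g h ≢ 0ℚ) ⊎ (∀ g h → W g h ≡ 0ℚ)
  nonzero-or-zero W with any? (λ g → any? (λ h → ¬? (W g h ℚ.≟ 0ℚ)))
  ... | yes W≢0 = inj₁ W≢0
  ... | no ¬W≢0 = inj₂ (λ g h → decidable-stable (W g h ℚ.≟ 0ℚ) (λ W≢0 → ¬W≢0 (g , h , W≢0)))

  -- The Kronecker product M ⊗ N acting on W, read as a vector indexed by Fin k × Fin l.
  _⊗_·_ : Matrix k → Matrix l → (Fin k → Fin l → ℚ) → Fin k → Fin l → ℚ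
  (M ⊗ N · W) g h = (M · (λ g' → (N · W g') h)) g

  ⊗-singular : (M : Matrix k) (N : Matrix l) (W : Fin k → Fin l → ℚ) →
               (∃₂ λ g h → W g h ≢ 0ℚ) → (∀ g h → (M ⊗ N · W) g h ≡ 0ℚ) →
               Singular M ⊎ Singular N
  ⊗-singular M N W (g₀ , h₀ , W≢0) M⊗NW≡0 with nonzero-or-zero (λ g h → (N · W g) h)
  ... | inj₁ (g , h , NW≢0) = inj₁ ((λ g' → (N · W g') h) , (g , NW≢0) , λ g' → M⊗NW≡0 g' h)
  ... | inj₂ NW≡0           = inj₂ (W g₀ , (h₀ , W≢0) , NW≡0 g₀)

  ⊗-kernel : (M : Matrix k) (N : Matrix l) {a b K : ℚ} (L : Fin k → Fin l → ℚ) →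
             (∀ x → (M · (λ _ → 1ℚ)) x ≡ a) → (∀ y → (N · (λ _ → 1ℚ)) y ≡ b) →
             (∀ g h → (M ⊗ N · L) g h ≡ K) →
             ∀ g h → (M ⊗ N · (λ g' h' → a * b * L g' h' - K)) g h ≡ 0ℚ
  ⊗-kernel M N {a} {b} {K} L M𝟙≡a N𝟙≡b M⊗NL≡K g h = begin
    (M · (λ g' → (N · (λ h' → a * b * L g' h' - K)) h)) g
      ≡⟨ ·-cong M N-step g ⟩
    (M · (λ g' → a * b * (N · L g') h - K * b)) g
      ≡⟨ ·-affine M (a * b) (K * b) (λ g' → (N · L g') h) g ⟩
    a * b * (M ⊗ N · L) g h - K * b * (M · (λ _ → 1ℚ)) g
      ≡⟨ cong₂ (λ s t → a * b * s - K * b * t) (M⊗NL≡K g h) (M𝟙≡a g) ⟩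
    a * b * K - K * b * a
      ≡⟨ solve 3 (λ a b K → a :* b :* K :- K :* b :* a := con 0ℚ) refl a b K ⟩
    0ℚ
      ∎
    where
    N-step : ∀ g' → (N · (λ h' → a * b * L g' h' - K)) h ≡ a * b * (N · L g') h - K * b
    N-step g' = trans (·-affine N (a * b) K (L g') h) (cong (λ t → a * b * (N · L g') h - K * t) (N𝟙≡b h))

  affine-nonzero : (L : Fin k → Fin l → ℚ) {c K : ℚ} {g g' : Fin k} {h h' : Fin l} →
                   c ≢ 0ℚ → L g' h' ≡ 1ℚ + L g h → ∃₂ λ g h → c * L g h - K ≢ 0ℚ
  affine-nonzero L {c} {K} {g} {g'} {h} {h'} c≢0 L′≡1+L with nonzero-or-zero (λ g h → c * L g h - K)
  ... | inj₁ W≢0 = W≢0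
  ... | inj₂ W≡0 = contradiction c≡0 c≢0
    where
    c≡0 : c ≡ 0ℚ
    c≡0 = begin
      c
        ≡⟨ solve 3 (λ c x K → c := (c :* (con 1ℚ :+ x) :- K) :- (c :* x :- K)) refl c (L g h) K ⟩
      (c * (1ℚ + L g h) - K) - (c * L g h - K)
        ≡⟨ cong (λ t → (c * t - K) - (c * L g h - K)) L′≡1+L ⟨
      (c * L g' h' - K) - (c * L g h - K)
        ≡⟨ cong₂ _-_ (W≡0 g' h') (W≡0 g h) ⟩
      0ℚ
        ∎

  ⊗-magic⇒singular : (M : Matrix k) (N : Matrix l) {a b K : ℚ} (L : Fin k → Fin l → ℚ) →
                     a * b ≢ 0ℚ → (∃₂ λ g g' → ∃₂ λ h h' → L g' h' ≡ 1ℚ + L g h) →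
                     (∀ x → (M · (λ _ → 1ℚ)) x ≡ a) → (∀ y → (N · (λ _ → 1ℚ)) y ≡ b) →
                     (∀ g h → (M ⊗ N · L) g h ≡ K) → Singular M ⊎ Singular N
  ⊗-magic⇒singular M N L ab≢0 (g , g' , h , h' , L′≡1+L) M𝟙≡a N𝟙≡b M⊗NL≡K =
    ⊗-singular M N _ (affine-nonzero L ab≢0 L′≡1+L) (⊗-kernel M N L M𝟙≡a N𝟙≡b M⊗NL≡K)

  indicator : Bool → ℚ
  indicator b = if b then 1ℚ else 0ℚ

  sum-indicator-≟ : ∀ {k} (x : Fin k) (v : Vector ℚ k) → sum (λ y → indicator ⌊ x ≟ y ⌋ * v y) ≡ v x
  sum-indicator-≟ {suc k} zero v = begin
    1ℚ * v zero + sum (λ i → 0ℚ * v (suc i))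
      ≡⟨ cong₂ _+_ (ℚ.*-identityˡ (v zero)) (sum-cong-≗ (λ i → ℚ.*-zeroˡ (v (suc i)))) ⟩
    v zero + sum (λ (_ : Fin k) → 0ℚ)
      ≡⟨ cong (v zero +_) (sum-replicate-zero k) ⟩
    v zero + 0ℚ
      ≡⟨ ℚ.+-identityʳ (v zero) ⟩
    v zero
      ∎
  sum-indicator-≟ {suc k} (suc x) v = begin
    0ℚ * v zero + sum (λ y → indicator ⌊ suc x ≟ suc y ⌋ * v (suc y))
      ≡⟨ cong₂ _+_ (ℚ.*-zeroˡ (v zero)) (sum-cong-≗ ≟-suc) ⟩
    0ℚ + sum (λ y → indicator ⌊ x ≟ y ⌋ * v (suc y))
      ≡⟨ ℚ.+-identityˡ _ ⟩
    sum (λ y → indicator ⌊ x ≟ y ⌋ * v (suc y))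
      ≡⟨ sum-indicator-≟ x (λ y → v (suc y)) ⟩
    v (suc x)
      ∎
    where
    ≟-suc : ∀ y → indicator ⌊ suc x ≟ suc y ⌋ * v (suc y) ≡ indicator ⌊ x ≟ y ⌋ * v (suc y)
    ≟-suc y = cong (λ b → indicator b * v (suc y)) (⌊⌋-map′ (cong suc) suc-injective (x ≟ y))

  closedAdjMatrix : (G : Graph) → Matrix (n G)
  closedAdjMatrix G x y = indicator (inClosedNbhd (n G) (adj G) x y)

  closedAdjMatrix≡I+A : (G : Graph) (x y : Fin (n G)) →
                        closedAdjMatrix G x y ≡ indicator ⌊ x ≟ y ⌋ + adjMatrix G x y
  closedAdjMatrix≡I+A G x y with x ≟ y
  ... | yes refl rewrite irrefl G x = refl
  ... | no _ = sym (ℚ.+-identityˡ (adjMatrix G x y))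

  closedAdjMatrix-· : (G : Graph) (v : Vector ℚ (n G)) →
                      ∀ x → (closedAdjMatrix G · v) x ≡ v x + (adjMatrix G · v) x
  closedAdjMatrix-· G v x = begin
    sum (λ y → closedAdjMatrix G x y * v y)
      ≡⟨ sum-cong-≗ split ⟩
    sum (λ y → indicator ⌊ x ≟ y ⌋ * v y + adjMatrix G x y * v y)
      ≡⟨ ∑-distrib-+ (λ y → indicator ⌊ x ≟ y ⌋ * v y) (λ y → adjMatrix G x y * v y) ⟩
    sum (λ y → indicator ⌊ x ≟ y ⌋ * v y) + sum (λ y → adjMatrix G x y * v y)
      ≡⟨ cong (_+ (adjMatrix G · v) x) (sum-indicator-≟ x v) ⟩
    v x + (adjMatrix G · v) x
      ∎
    where
    split : ∀ y → closedAdjMatrix G x y * v y ≡ indicator ⌊ x ≟ y ⌋ * v y + adjMatrix G x y * v y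
    split y = trans (cong (_* v y) (closedAdjMatrix≡I+A G x y))
                    (ℚ.*-distribʳ-+ (v y) (indicator ⌊ x ≟ y ⌋) (adjMatrix G x y))

  adjMatrix-·-𝟙 : (G : Graph) → ∀ x → (adjMatrix G · (λ _ → 1ℚ)) x ≡ fromℕ (degree G x)
  adjMatrix-·-𝟙 G x = trans (sum-cong-≗ (λ y → indicator*1≡fromℕ (adj G x y))) (sym (fromℕ-Σℕ (n G) _))
    where
    indicator*1≡fromℕ : ∀ b → indicator b * 1ℚ ≡ fromℕ (if b then 1 else 0)
    indicator*1≡fromℕ true  = refl
    indicator*1≡fromℕ false = refl

  closedAdjMatrix-·-𝟙 : (G : Graph) {r : ℕ} → (∀ x → degree G x ≡ r) →
                        ∀ x → (closedAdjMatrix G · (λ _ → 1ℚ)) x ≡ fromℕ (suc r)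
  closedAdjMatrix-·-𝟙 G deg≡r x =
    trans (closedAdjMatrix-· G _ x) (cong (1ℚ +_) (trans (adjMatrix-·-𝟙 G x) (cong fromℕ (deg≡r x))))

  singular-closedAdjMatrix⇒-1∈Sp : (G : Graph) → Singular (closedAdjMatrix G) → (- 1ℚ) ∈Sp G
  singular-closedAdjMatrix⇒-1∈Sp G (v , v≢0 , Nv≡0) = v , v≢0 , λ x → begin
    Σℚ (n G) (λ y → adjMatrix G x y * v y)
      ≡⟨ Σℚ≡sum (n G) _ ⟩
    (adjMatrix G · v) x
      ≡⟨ solve 2 (λ u s → s := (u :+ s) :+ con (- 1ℚ) :* u) refl (v x) _ ⟩
    (v x + (adjMatrix G · v) x) + - 1ℚ * v x
      ≡⟨ cong (_+ - 1ℚ * v x) (trans (sym (closedAdjMatrix-· G v x)) (Nv≡0 x)) ⟩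
    0ℚ + - 1ℚ * v x
      ≡⟨ ℚ.+-identityˡ _ ⟩
    - 1ℚ * v x
      ∎

  combine-≟ : (g g' : Fin k) (h h' : Fin l) → ⌊ combine g h ≟ combine g' h' ⌋ ≡ ⌊ g ≟ g' ⌋ ∧ ⌊ h ≟ h' ⌋
  combine-≟ g g' h h' with g ≟ g' | h ≟ h'
  ... | yes refl | yes refl =
    trans (isYes≗does _) (dec-true (combine g h ≟ combine g h) refl)
  ... | no g≢g'  | _        =
    trans (isYes≗does _) (dec-false (combine g h ≟ combine g' h') (g≢g' ∘ combine-injectiveˡ g h g' h'))
  ... | yes _    | no h≢h'  =
    trans (isYes≗does _) (dec-false (combine g h ≟ combine g' h') (h≢h' ∘ combine-injectiveʳ g h g' h'))

  strongAdj-combine : (G H : Graph) (g g' : Fin (n G)) (h h' : Fin (n H)) →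
    strongAdj G H (combine g h) (combine g' h') ≡
    (⌊ g ≟ g' ⌋ ∧ adj H h h') ∨ ((⌊ h ≟ h' ⌋ ∧ adj G g g') ∨ (adj G g g' ∧ adj H h h'))
  strongAdj-combine G H g g' h h' = cong₂ edge (remQuot-combine g h) (remQuot-combine g' h')
    where
    edge : Fin (n G) × Fin (n H) → Fin (n G) × Fin (n H) → Bool
    edge (g , h) (g' , h') = (⌊ g ≟ g' ⌋ ∧ adj H h h') ∨ ((⌊ h ≟ h' ⌋ ∧ adj G g g') ∨ (adj G g g' ∧ adj H h h'))

  inClosedNbhd-strong : (G H : Graph) (g g' : Fin (n G)) (h h' : Fin (n H)) →
    inClosedNbhd (n G ℕ.* n H) (strongAdj G H) (combine g h) (combine g' h') ≡
    inClosedNbhd (n G) (adj G) g g' ∧ inClosedNbhd (n H) (adj H) h h'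
  inClosedNbhd-strong G H g g' h h' = begin
    ⌊ combine g h ≟ combine g' h' ⌋ ∨ strongAdj G H (combine g h) (combine g' h')
      ≡⟨ cong₂ _∨_ (combine-≟ g g' h h') (strongAdj-combine G H g g' h h') ⟩
    (eg ∧ eh) ∨ ((eg ∧ aH) ∨ ((eh ∧ aG) ∨ (aG ∧ aH)))
      ≡⟨ ∧-∨-expand eg aG eh aH ⟩
    (eg ∨ aG) ∧ (eh ∨ aH)
      ∎
    where
    eg = ⌊ g ≟ g' ⌋
    eh = ⌊ h ≟ h' ⌋
    aG = adj G g g'
    aH = adj H h h'

  label : (Fin (k ℕ.* l) → Fin (k ℕ.* l)) → Fin k → Fin l → ℚ
  label ℓ' g h = fromℕ (suc (toℕ (ℓ' (combine g h))))

  fromℕ-if-∧ : ∀ a b s → fromℕ (if a ∧ b then s else 0) ≡ indicator a * (indicator b * fromℕ s)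
  fromℕ-if-∧ true  true  s = sym (trans (ℚ.*-identityˡ _) (ℚ.*-identityˡ (fromℕ s)))
  fromℕ-if-∧ true  false s = sym (trans (ℚ.*-identityˡ _) (ℚ.*-zeroˡ (fromℕ s)))
  fromℕ-if-∧ false b     s = sym (ℚ.*-zeroˡ (indicator b * fromℕ s))

  strong-magic⇒⊗-magic : (G H : Graph) (ℓ' : Fin (n G ℕ.* n H) → Fin (n G ℕ.* n H)) {k' : ℕ} →
    (∀ p → Σℕ (n G ℕ.* n H)
             (λ q → if inClosedNbhd (n G ℕ.* n H) (strongAdj G H) p q then suc (toℕ (ℓ' q)) else 0) ≡ k') →
    ∀ g h → (closedAdjMatrix G ⊗ closedAdjMatrix H · label ℓ') g h ≡ fromℕ k'
  strong-magic⇒⊗-magic G H ℓ' {k'} magic g h = begin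
    sum (λ g' → N_G g g' * sum (λ h' → N_H h h' * label ℓ' g' h'))
      ≡⟨ sum-cong-≗ (λ g' → *-distribˡ-sum (N_G g g') (λ h' → N_H h h' * label ℓ' g' h')) ⟩
    sum (λ g' → sum (λ h' → N_G g g' * (N_H h h' * label ℓ' g' h')))
      ≡⟨ sum-cong-≗ (λ g' → sum-cong-≗ (term g')) ⟨
    sum (λ (g' : Fin (n G)) → sum (λ (h' : Fin (n H)) → fromℕ (F (combine g' h'))))
      ≡⟨ sum-combine ℚ.+-0-monoid (n G) (n H) (fromℕ ∘ F) ⟨
    sum (fromℕ ∘ F)
      ≡⟨ fromℕ-Σℕ (n G ℕ.* n H) F ⟨
    fromℕ (Σℕ (n G ℕ.* n H) F)
      ≡⟨ cong fromℕ (magic (combine g h)) ⟩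
    fromℕ k'
      ∎
    where
    N_G = closedAdjMatrix G
    N_H = closedAdjMatrix H
    F : Fin (n G ℕ.* n H) → ℕ
    F q = if inClosedNbhd (n G ℕ.* n H) (strongAdj G H) (combine g h) q then suc (toℕ (ℓ' q)) else 0
    term : ∀ (g' : Fin (n G)) (h' : Fin (n H)) →
           fromℕ (F (combine g' h')) ≡ N_G g g' * (N_H h h' * label ℓ' g' h')
    term g' h' =
      trans (cong (λ b → fromℕ (if b then suc (toℕ (ℓ' (combine g' h'))) else 0))
                  (inClosedNbhd-strong G H g g' h h'))
            (fromℕ-if-∧ (inClosedNbhd (n G) (adj G) g g') (inClosedNbhd (n H) (adj H) h h') _)

  adjacent-elements : ∀ {N} → 2 ℕ.≤ N → ∃₂ λ (e e' : Fin N) → toℕ e' ≡ suc (toℕ e)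
  adjacent-elements (s≤s (s≤s _)) = zero , suc zero , refl

  surjective-combine : (ℓ' : Fin (k ℕ.* l) → Fin (k ℕ.* l)) → Surjective _≡_ _≡_ ℓ' →
                       ∀ e → ∃₂ λ (g : Fin k) (h : Fin l) → ℓ' (combine g h) ≡ e
  surjective-combine {k} {l} ℓ' surj e with surj e
  ... | p , ℓ'≡e = proj₁ (remQuot {k} l p) , proj₂ (remQuot {k} l p) , ℓ'≡e (combine-remQuot {k} l p)

  consecutive-labels : 2 ℕ.≤ k ℕ.* l → (ℓ' : Fin (k ℕ.* l) → Fin (k ℕ.* l)) → Surjective _≡_ _≡_ ℓ' →
                       ∃₂ λ (g g' : Fin k) → ∃₂ λ (h h' : Fin l) → label ℓ' g' h' ≡ 1ℚ + label ℓ' g h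
  consecutive-labels 2≤kl ℓ' surj =
    let e , e' , e'≡1+e     = adjacent-elements 2≤kl
        g , h , ℓ'gh≡e      = surjective-combine ℓ' surj e
        g' , h' , ℓ'g'h'≡e' = surjective-combine ℓ' surj e'
    in g , g' , h , h' , cong (λ (t : ℕ) → fromℕ (suc t)) (begin
      toℕ (ℓ' (combine g' h'))      ≡⟨ cong toℕ ℓ'g'h'≡e' ⟩
      toℕ e'                        ≡⟨ e'≡1+e ⟩
      suc (toℕ e)                   ≡⟨ cong (λ p → suc (toℕ p)) ℓ'gh≡e ⟨
      suc (toℕ (ℓ' (combine g h)))  ∎)

open import Data.Nat using (_*_; _≤_)

mainTheorem6 : (G H : Graph) → 2 ≤ n G * n H → Regular G → Regular H →
    ClosedDistanceMagic (n G * n H) (strongAdj G H) →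
    ((- 1ℚ) ∈Sp G) ⊎ ((- 1ℚ) ∈Sp H)
mainTheorem6 G H 2≤|V| (r , G-regular) (s , H-regular) (ℓ' , (_ , ℓ'-surjective) , k' , _ , ℓ'-magic) =
  Sum.map (singular-closedAdjMatrix⇒-1∈Sp G) (singular-closedAdjMatrix⇒-1∈Sp H)
    (⊗-magic⇒singular (closedAdjMatrix G) (closedAdjMatrix H) (label ℓ')
      (fromℕ-suc*fromℕ-suc≢0 r s)
      (consecutive-labels 2≤|V| ℓ' ℓ'-surjective)
      (closedAdjMatrix-·-𝟙 G G-regular)
      (closedAdjMatrix-·-𝟙 H H-regular)
      (strong-magic⇒⊗-magic G H ℓ' ℓ'-magic))
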